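{- Let $G=(V,E,\mathcal{K})$ be a finite undirected graph with vertex set $V$, edge set $E$, and terminal set $\mathcal{K}\subseteq V$, and let $P=(p_e)_{e\in E}$ be edge failure probabilities. Let $F_{\mathcal{K}}$ and $\Omega_f$ be as defined in the context. Then $\#F_{\mathcal{K}}=|\Omega_f|$. Moreover, for $P_{1/2}=(1/2)_{e\in E}$ (every edge fails independently with probability $1/2$), $$u_G(P_{1/2})=\frac{\#F_{\mathcal{K}}}{2^{|E|}}.$$
   Context: A realization of the stochastic graph is a vector $X=(x_e)_{e\in E}\in\Omega=\{0,1\}^{|E|}$, where $x_e=0$ means edge $e$ has failed and $x_e=1$ means it works; under $P$, the $x_e$ are independent with $\Pr(x_e=0)=p_e$. Let $\Phi(X)=1$ if all vertices of $\mathcal{K}$ lie in a single connected component of the subgraph $(V,\{e\in E: x_e=1\})$, and $\Phi(X)=0$ otherwise (i.e. some subset of $\mathcal{K}$ becomes disconnected). The failure domain is $\Omega_f=\{X\in\Omega:\Phi(X)=0\}$, and the unreliability $u_G(P)$ is the probability, under $P$, that $\Phi(X)=0$. Boolean encoding: take propositional variables $S=(s_u)_{u\in V}$ and $X=(x_e)_{e\in E}$. For each edge $e\in E$ with end vertices $u,v$, let $C_e=[(s_u\wedge x_e)\rightarrow s_v]\wedge[(s_v\wedge x_e)\rightarrow s_u]$. Let $\psi(X,S)=\big(\bigvee_{j\in\mathcal{K}}s_j\big)\wedge\big(\bigvee_{k\in\mathcal{K}}\neg s_k\big)\wedge\bigwedge_{e\in E}C_e$ and $F_{\mathcal{K}}=\exists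 S[\psi(X,S)]$. Its projected model count is $\#F_{\mathcal{K}}=\big|\{X\in\{0,1\}^{|E|}:\exists S\in\{0,1\}^{|V|}\text{ with }\psi(X,S)=1\}\big|$. -}

module Defs where

open import Data.Bool using (Bool; true; false; _∧_; _∨_; not; if_then_else_)
open import Data.Nat using (ℕ; zero; suc; _^_)
open import Data.Nat.Properties using (m^n≢0)
open import Data.Fin using (Fin)
open import Data.Vec using (Vec; []; _∷_; lookup)
open import Data.List using (List; []; _∷_; map; concatMap; allFin; foldr; filter; length)
open import Data.Bool.ListAction using (and; any)
open import Data.Product using (_×_; _,_; proj₁; proj₂)
open import Data.Integer using (+_)
open import Data.Rational using (ℚ; 0ℚ; 1ℚ; _+_; _*_; _-_; _/_)
open import Relation.Binary.PropositionalEquality using (_≡_)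
open import Relation.Nullary using (¬_; Dec; does)
open import Relation.Unary using (Decidable)

-- A finite undirected (multi)graph G = (V, E, K):
--   V = Fin n, E = Fin m, each edge has an (unordered) pair of end vertices,
--   K ⊆ V given by its characteristic function.
record Graph : Set where
  field
    n     : ℕ
    m     : ℕ
    ends  : Fin m → Fin n × Fin n
    term  : Fin n → Bool
open Graph public

-- Realizations X ∈ Ω = {0,1}^|E|  (true = edge works, false = edge failed)
Realization : Graph → Set
Realization G = Vec Bool (m G)

allVecs : (k : ℕ) → List (Vec Bool k)
allVecs zero    = [] ∷ []
allVecs (suc k) = concatMap (λ v → (false ∷ v) ∷ (true ∷ v) ∷ []) (allVecs k)

data Reach (G : Graph) (X : Realization G) (u : Fin (n G)) : Fin (n G) → Set where
  here  : Reach G X u u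
  fwd   : (e : Fin (m G)) → lookup X e ≡ true →
          Reach G X u (proj₁ (ends G e)) → Reach G X u (proj₂ (ends G e))
  bwd   : (e : Fin (m G)) → lookup X e ≡ true →
          Reach G X u (proj₂ (ends G e)) → Reach G X u (proj₁ (ends G e))

Φ : (G : Graph) → Realization G → Set
Φ G X = ∀ j k → term G j ≡ true → term G k ≡ true → Reach G X j k

-- Failure domain Ω_f = {X : Φ(X) = 0}; its cardinality, computed with any
-- decision procedure for Φ (the result does not depend on the choice).
card-Ωf : (G : Graph) → Decidable (Φ G) → ℕ
card-Ωf G dec = length (filter (λ X → Relation.Nullary.¬? (dec X)) (allVecs (m G)))

_⇒ᵇ_ : Bool → Bool → Bool
a ⇒ᵇ b = not a ∨ b

C : (G : Graph) → Vec Bool (m G) → Vec Bool (n G) → Fin (m G) → Bool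
C G X S e =
  let u = proj₁ (ends G e) ; v = proj₂ (ends G e) in
  ((lookup S u ∧ lookup X e) ⇒ᵇ lookup S v) ∧ ((lookup S v ∧ lookup X e) ⇒ᵇ lookup S u)

ψ : (G : Graph) → Vec Bool (m G) → Vec Bool (n G) → Bool
ψ G X S =
  any (λ j → term G j ∧ lookup S j) (allFin (n G)) ∧
  any (λ k → term G k ∧ not (lookup S k)) (allFin (n G)) ∧
  and (map (C G X S) (allFin (m G)))

F : (G : Graph) → Vec Bool (m G) → Bool
F G X = any (ψ G X) (allVecs (n G))

#F : Graph → ℕ
#F G = length (filter (λ X → F G X Data.Bool.≟ true) (allVecs (m G)))

probX : (G : Graph) → (Fin (m G) → ℚ) → Realization G → ℚ
probX G p X = foldr _*_ 1ℚ (map (λ e → if lookup X e then 1ℚ - p e else p e) (allFin (m G)))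

sumℚ : List ℚ → ℚ
sumℚ = foldr _+_ 0ℚ

unreliability : (G : Graph) → Decidable (Φ G) → (Fin (m G) → ℚ) → ℚ
unreliability G dec p =
  sumℚ (map (probX G p) (filter (λ X → Relation.Nullary.¬? (dec X)) (allVecs (m G))))

half : (G : Graph) → Fin (m G) → ℚ
half G e = (+ 1) / 2

_/2^_ : ℕ → ℕ → ℚ
k /2^ e = _/_ (+ k) (2 ^ e) {{m^n≢0 2 e}}

module Submission where

-- For a fixed realization X, a vertex
-- assignment S satisfies every clause C_e iff S is *closed*: each working
-- edge has both ends in S or both outside S.  A closed S is constant along
-- working paths, so a satisfying S of ψ (closed, containing a terminal and
-- missing a terminal) separates two terminals, i.e. F(X) ⇒ ¬Φ(X).
-- Conversely, the set of vertices reachable from a terminal j is closed;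
-- it is built by growing a set of reachable vertices along edges leaving it
-- (each step enlarges it, so |V| steps suffice).  If it misses a terminal k,
-- it is a model S of ψ; hence ¬F(X) ⇒ Φ(X).  So F(X) ⇔ ¬Φ(X) and the two
-- filters counted by #F and |Ω_f| coincide.
--
-- Arithmetic half.  Under P_{1/2} every realization has probability
-- 1/2^|E|, so summing over Ω_f gives |Ω_f| / 2^|E| = #F / 2^|E|.

open import Defs
open import Data.Product using (_×_)
open import Relation.Binary.PropositionalEquality using (_≡_)
open import Relation.Unary using (Decidable)

open import Data.Bool as Bool using (Bool; true; false; _∧_; not; T; if_then_else_)
open import Data.Bool.Properties using (T-≡; T-∧)
open import Data.Bool.ListAction using (all; any)
open import Data.Nat as ℕ using (ℕ; zero; suc; NonZero; _<_)
import Data.Nat.Properties as ℕ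
open import Data.Fin using (Fin)
open import Data.Fin.Properties using (all?; ¬∀⟶∃¬)
open import Data.Fin.Subset using (Subset; _∪_; ⁅_⁆; ∣_∣)
  renaming (_∈_ to _∈ₛ_; _∉_ to _∉ₛ_)
open import Data.Fin.Subset.Properties
  using (∣p∣≤n; ∣⁅x⁆∣≡1; x∈⁅x⁆; x∈⁅y⁆⇒x≡y; x∈p∪q⁺; x∈p∪q⁻; p⊆p∪q; p⊂q⇒∣p∣<∣q∣)
open import Data.Vec as Vec using (Vec; lookup)
open import Data.Vec.Properties using ([]=⇒lookup; lookup⇒[]=)
open import Data.List as List using (List; []; _∷_; allFin; filter; length)
open import Data.List.Properties using (filter-≐; length-tabulate)
open import Data.List.Relation.Unary.Any using (here; there; satisfied)
open import Data.List.Relation.Unary.Any.Properties using (any⁺; any⁻)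
open import Data.List.Relation.Unary.All.Properties using (all⁺; all⁻)
open import Data.List.Relation.Unary.All as All using ()
open import Data.List.Membership.Propositional using (_∈_; lose)
open import Data.List.Membership.Propositional.Properties
  using (∈-allFin; ∈-map⁺; ∈-concat⁺′)
open import Data.Product using (Σ-syntax; _,_; proj₁; proj₂)
open import Data.Sum using (inj₁; inj₂)
open import Data.Empty using (⊥-elim)
open import Function.Bundles using (_⇔_; mk⇔; Equivalence)
open import Data.Integer as ℤ using (+_)
open import Data.Integer.Properties using (pos-+; pos-*)
open import Data.Integer.Tactic.RingSolver using (solve-∀)
open import Data.Rational using (ℚ; 1ℚ; _+_; _*_; _-_; _/_; toℚᵘ)
open import Data.Rational.Properties using (toℚᵘ-injective; toℚᵘ-homo-+; toℚᵘ-homo-*; toℚᵘ-fromℚᵘ; 0/n≡0)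
open import Data.Rational.Unnormalised as ℚᵘ using (mkℚᵘ; *≡*; _≃_)
import Data.Rational.Unnormalised.Properties as ℚᵘ
open import Relation.Nullary using (¬_; Dec; yes; no; ¬?)
open import Relation.Nullary.Decidable using (_→-dec_)
open import Relation.Binary.PropositionalEquality
  using (refl; sym; trans; cong; cong₂; subst; module ≡-Reasoning)

∧-spec : ∀ a b → T (a ∧ b) ⇔ (a ≡ true × b ≡ true)
∧-spec true  true  = mk⇔ (λ _ → refl , refl) (λ _ → _)
∧-spec true  false = mk⇔ (λ ()) (λ { (_ , ()) })
∧-spec false b     = mk⇔ (λ ()) (λ { (() , _) })

∧-not-spec : ∀ a b → T (a ∧ not b) ⇔ (a ≡ true × b ≡ false)
∧-not-spec true  false = mk⇔ (λ _ → refl , refl) (λ _ → _)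
∧-not-spec true  true  = mk⇔ (λ ()) (λ { (_ , ()) })
∧-not-spec false b     = mk⇔ (λ ()) (λ { (() , _) })

any-allFin-spec : ∀ {k} (p : Fin k → Bool) → T (any p (allFin k)) ⇔ (Σ[ i ∈ Fin k ] T (p i))
any-allFin-spec {k} p = mk⇔ (λ t → satisfied (any⁻ p (allFin k) t))
                        (λ (i , pi) → any⁺ {xs = allFin _} p (lose (∈-allFin i) pi))

all-allFin-spec : ∀ {k} (p : Fin k → Bool) → T (all p (allFin k)) ⇔ (∀ i → T (p i))
all-allFin-spec p = mk⇔ (λ t i → All.lookup (all⁺ p _ t) (∈-allFin i))
                        (λ ps → all⁻ p {allFin _} (All.tabulate λ {i} _ → ps i))

∈-allVecs : ∀ k (v : Vec Bool k) → v ∈ allVecs k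
∈-allVecs zero    Vec.[]          = here refl
∈-allVecs (suc k) (false Vec.∷ v) = ∈-concat⁺′ (here refl)         (∈-map⁺ _ (∈-allVecs k v))
∈-allVecs (suc k) (true  Vec.∷ v) = ∈-concat⁺′ (there (here refl)) (∈-map⁺ _ (∈-allVecs k v))

clause-spec : ∀ a x b → (((a ∧ x) ⇒ᵇ b) ∧ ((b ∧ x) ⇒ᵇ a) ≡ true) ⇔ (x ≡ true → a ≡ b)
clause-spec a false b = mk⇔ (λ _ ()) (λ _ → lemma a b)
  where
  lemma : ∀ a b → ((a ∧ false) ⇒ᵇ b) ∧ ((b ∧ false) ⇒ᵇ a) ≡ true
  lemma false false = refl
  lemma false true  = refl
  lemma true  false = refl
  lemma true  true  = refl
clause-spec false true false = mk⇔ (λ _ _ → refl) (λ _ → refl)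
clause-spec true  true true  = mk⇔ (λ _ _ → refl) (λ _ → refl)
clause-spec false true true  = mk⇔ (λ ()) (λ a≡b → a≡b refl)
clause-spec true  true false = mk⇔ (λ ()) (λ a≡b → sym (a≡b refl))

module Connectivity (G : Graph) (X : Realization G) where

  private
    V : Set
    V = Fin (n G)

    src tgt : Fin (m G) → V
    src e = proj₁ (ends G e)
    tgt e = proj₂ (ends G e)

  Respects : Vec Bool (n G) → Fin (m G) → Set
  Respects S e = lookup X e ≡ true → lookup S (src e) ≡ lookup S (tgt e)

  Closed : Vec Bool (n G) → Set
  Closed S = ∀ e → Respects S e

  C-spec : ∀ S e → (C G X S e ≡ true) ⇔ Respects S e
  C-spec S e = clause-spec (lookup S (src e)) (lookup X e) (lookup S (tgt e))

  closed-constant : ∀ S {j w} → Closed S → Reach G X j w → lookup S j ≡ lookup S w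
  closed-constant S closed here         = refl
  closed-constant S closed (fwd e xe r) = trans (closed-constant S closed r) (closed e xe)
  closed-constant S closed (bwd e xe r) = trans (closed-constant S closed r) (sym (closed e xe))

  Separating : Vec Bool (n G) → Set
  Separating S = Closed S
               × (Σ[ j ∈ V ] term G j ≡ true × lookup S j ≡ true)
               × (Σ[ k ∈ V ] term G k ≡ true × lookup S k ≡ false)

  ψ-spec : ∀ S → T (ψ G X S) ⇔ Separating S
  ψ-spec S = mk⇔ to from
    where
    inS outS : V → Bool
    inS  j = term G j ∧ lookup S j
    outS k = term G k ∧ not (lookup S k)

    to : T (ψ G X S) → Separating S
    to t
      with t-in  , t-rest ← Equivalence.to T-∧ t
      with t-out , t-cls  ← Equivalence.to T-∧ t-rest
      with j , tj ← Equivalence.to (any-allFin-spec inS) t-in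
      with k , tk ← Equivalence.to (any-allFin-spec outS) t-out
      = closed , (j , Equivalence.to (∧-spec _ _) tj) , (k , Equivalence.to (∧-not-spec _ _) tk)
      where
      closed : Closed S
      closed e = Equivalence.to (C-spec S e)
        (Equivalence.to T-≡ (Equivalence.to (all-allFin-spec (C G X S)) t-cls e))

    from : Separating S → T (ψ G X S)
    from (closed , (j , tj) , (k , tk)) =
      Equivalence.from T-∧ (Equivalence.from (any-allFin-spec inS) (j , Equivalence.from (∧-spec _ _) tj) ,
      Equivalence.from T-∧ (Equivalence.from (any-allFin-spec outS) (k , Equivalence.from (∧-not-spec _ _) tk) ,
      Equivalence.from (all-allFin-spec (C G X S)) λ e →
        Equivalence.from T-≡ (Equivalence.from (C-spec S e) (closed e))))

  separating⇒¬Φ : ∀ S → Separating S → ¬ Φ G X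
  separating⇒¬Φ S (closed , (j , tj , j∈S) , (k , tk , k∉S)) φ
    with () ← trans (sym j∈S) (trans (closed-constant S closed (φ j k tj tk)) k∉S)

  module Component (j : V) where

    Sound : Subset (n G) → Set
    Sound S = ∀ {w} → w ∈ₛ S → Reach G X j w

    Frontier : Subset (n G) → Set
    Frontier S = Σ[ w ∈ V ] w ∉ₛ S × Reach G X j w

    respects? : ∀ (S : Subset (n G)) e → Dec (Respects S e)
    respects? S e = (lookup X e Bool.≟ true) →-dec (lookup S (src e) Bool.≟ lookup S (tgt e))

    ∉-from-lookup : ∀ (S : Subset (n G)) {w} → lookup S w ≡ false → w ∉ₛ S
    ∉-from-lookup S w∉S w∈S with () ← trans (sym ([]=⇒lookup w∈S)) w∉S

    broken⇒frontier : ∀ (S : Subset (n G)) e → Sound S → ¬ Respects S e → Frontier S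
    broken⇒frontier S e sound broken
      with lookup X e in xe | lookup S (src e) in s | lookup S (tgt e) in t
    ... | false | _     | _     = ⊥-elim (broken λ ())
    ... | true  | false | false = ⊥-elim (broken λ _ → refl)
    ... | true  | true  | true  = ⊥-elim (broken λ _ → refl)
    ... | true  | true  | false =
      tgt e , ∉-from-lookup S t , fwd e xe (sound (lookup⇒[]= (src e) S s))
    ... | true  | false | true  =
      src e , ∉-from-lookup S s , bwd e xe (sound (lookup⇒[]= (tgt e) S t))

    extend-sound : ∀ (S : Subset (n G)) {w} → Sound S → Reach G X j w → Sound (S ∪ ⁅ w ⁆)
    extend-sound S {w} sound r x∈ with x∈p∪q⁻ S ⁅ w ⁆ x∈
    ... | inj₁ x∈S = sound x∈S
    ... | inj₂ x∈w rewrite x∈⁅y⁆⇒x≡y w x∈w = r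

    extend-grows : ∀ (S : Subset (n G)) {w} → w ∉ₛ S → ∣ S ∣ < ∣ S ∪ ⁅ w ⁆ ∣
    extend-grows S {w} w∉S = p⊂q⇒∣p∣<∣q∣ (p⊆p∪q ⁅ w ⁆ , w , x∈p∪q⁺ (inj₂ (x∈⁅x⁆ w)) , w∉S)

    Component : Set
    Component = Σ[ S ∈ Subset (n G) ] j ∈ₛ S × Sound S × Closed S

    -- Grow a sound set containing j until it is closed.  Each step adds a
    -- vertex, and a set has at most n G vertices, so the fuel never runs out.
    grow : ∀ fuel (S : Subset (n G)) → n G < ∣ S ∣ ℕ.+ fuel → j ∈ₛ S → Sound S → Component
    grow zero S bound j∈S sound =
      ⊥-elim (ℕ.<⇒≱ bound (subst (ℕ._≤ n G) (sym (ℕ.+-identityʳ ∣ S ∣)) (∣p∣≤n S)))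
    grow (suc fuel) S bound j∈S sound with all? (respects? S)
    ... | yes closed = S , j∈S , sound , closed
    ... | no ¬closed
      with e , broken ← ¬∀⟶∃¬ (m G) _ (respects? S) ¬closed
      with w , w∉S , j⇝w ← broken⇒frontier S e sound broken
      = grow fuel (S ∪ ⁅ w ⁆) bound′ (p⊆p∪q ⁅ w ⁆ j∈S) (extend-sound S sound j⇝w)
      where
      bound′ : n G < ∣ S ∪ ⁅ w ⁆ ∣ ℕ.+ fuel
      bound′ = ℕ.<-≤-trans bound
        (subst (ℕ._≤ ∣ S ∪ ⁅ w ⁆ ∣ ℕ.+ fuel) (sym (ℕ.+-suc ∣ S ∣ fuel))
          (ℕ.+-monoˡ-≤ fuel (extend-grows S w∉S)))

    component : Component
    component = grow (n G) ⁅ j ⁆ bound (x∈⁅x⁆ j) sound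
      where
      bound : n G < ∣ ⁅ j ⁆ ∣ ℕ.+ n G
      bound rewrite ∣⁅x⁆∣≡1 j = ℕ.n<1+n (n G)
      sound : Sound ⁅ j ⁆
      sound x∈ rewrite x∈⁅y⁆⇒x≡y j x∈ = here

  F-spec : (F G X ≡ true) ⇔ (Σ[ S ∈ Vec Bool (n G) ] Separating S)
  F-spec = mk⇔ to from
    where
    to : F G X ≡ true → Σ[ S ∈ Vec Bool (n G) ] Separating S
    to F≡true with S , ψS ← satisfied (any⁻ (ψ G X) (allVecs (n G)) (Equivalence.from T-≡ F≡true))
      = S , Equivalence.to (ψ-spec S) ψS
    from : Σ[ S ∈ Vec Bool (n G) ] Separating S → F G X ≡ true
    from (S , sep) = Equivalence.to T-≡
      (any⁺ (ψ G X) (lose (∈-allVecs (n G) S) (Equivalence.from (ψ-spec S) sep)))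

  -- If F(X) fails, all terminals are connected: the component of a terminal j
  -- contains every terminal k, since otherwise it would separate j from k.
  F≡false⇒Φ : F G X ≡ false → Φ G X
  F≡false⇒Φ ¬F j k tj tk with S , j∈S , sound , closed ← Component.component j
                              | lookup S k in k∈S
  ... | true  = sound (lookup⇒[]= k S k∈S)
  ... | false with () ← trans (sym ¬F)
                          (Equivalence.from F-spec (S , closed , (j , tj , []=⇒lookup j∈S) , (k , tk , k∈S)))

  F⇔¬Φ : (F G X ≡ true) ⇔ (¬ Φ G X)
  F⇔¬Φ = mk⇔ to from
    where
    to : F G X ≡ true → ¬ Φ G X
    to F≡true with S , sep ← Equivalence.to F-spec F≡true = separating⇒¬Φ S sep

    from : ¬ Φ G X → F G X ≡ true
    from ¬φ with F G X in eq
    ... | true  = refl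
    ... | false = ⊥-elim (¬φ (F≡false⇒Φ eq))

#F≡card-Ωf : (G : Graph) (dec : Decidable (Φ G)) → #F G ≡ card-Ωf G dec
#F≡card-Ωf G dec =
  cong length (filter-≐ (λ X → F G X Bool.≟ true) (λ X → ¬? (dec X))
                        ((λ {X} → Equivalence.to (F⇔¬Φ X)) , (λ {X} → Equivalence.from (F⇔¬Φ X)))
                        (allVecs (m G)))
  where open Connectivity G

-- Arithmetic of non-negative fractions a / n in ℚ, checked on unnormalised
-- representatives, where a / (suc d) is just the pair (a, d).
toℚᵘ-/ : ∀ a d → toℚᵘ (+ a / suc d) ≃ mkℚᵘ (+ a) d
toℚᵘ-/ a d = toℚᵘ-fromℚᵘ (mkℚᵘ (+ a) d)

/-+ : ∀ a b n .{{_ : NonZero n}} → (+ a / n) + (+ b / n) ≡ + (a ℕ.+ b) / n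
/-+ a b n@(suc d) = toℚᵘ-injective (begin
  toℚᵘ ((+ a / n) + (+ b / n))            ≈⟨ toℚᵘ-homo-+ (+ a / n) (+ b / n) ⟩
  toℚᵘ (+ a / n) ℚᵘ.+ toℚᵘ (+ b / n)     ≈⟨ ℚᵘ.+-cong (toℚᵘ-/ a d) (toℚᵘ-/ b d) ⟩
  mkℚᵘ (+ a) d ℚᵘ.+ mkℚᵘ (+ b) d         ≈⟨ *≡* numerators ⟩
  mkℚᵘ (+ (a ℕ.+ b)) d                    ≈⟨ toℚᵘ-/ (a ℕ.+ b) d ⟨
  toℚᵘ (+ (a ℕ.+ b) / n)                  ∎)
  where
  open ℚᵘ.≃-Reasoning
  D = + n
  numerators : (+ a ℤ.* D ℤ.+ + b ℤ.* D) ℤ.* D ≡ + (a ℕ.+ b) ℤ.* + (n ℕ.* n)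
  numerators = trans (factor (+ a) (+ b) D) (cong₂ ℤ._*_ (sym (pos-+ a b)) (sym (pos-* n n)))
    where
    factor : ∀ x y z → (x ℤ.* z ℤ.+ y ℤ.* z) ℤ.* z ≡ (x ℤ.+ y) ℤ.* (z ℤ.* z)
    factor = solve-∀

/-* : ∀ a b n n′ .{{_ : NonZero n}} .{{_ : NonZero n′}} →
      (+ a / n) * (+ b / n′) ≡ _/_ (+ (a ℕ.* b)) (n ℕ.* n′) {{ℕ.m*n≢0 n n′}}
/-* a b n@(suc d) n′@(suc d′) = toℚᵘ-injective (begin
  toℚᵘ ((+ a / n) * (+ b / n′))           ≈⟨ toℚᵘ-homo-* (+ a / n) (+ b / n′) ⟩
  toℚᵘ (+ a / n) ℚᵘ.* toℚᵘ (+ b / n′)    ≈⟨ ℚᵘ.*-cong (toℚᵘ-/ a d) (toℚᵘ-/ b d′) ⟩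
  mkℚᵘ (+ a) d ℚᵘ.* mkℚᵘ (+ b) d′        ≈⟨ *≡* (cong₂ ℤ._*_ (sym (pos-* a b)) refl) ⟩
  mkℚᵘ (+ (a ℕ.* b)) (ℕ.pred (n ℕ.* n′))  ≈⟨ toℚᵘ-/ (a ℕ.* b) (ℕ.pred (n ℕ.* n′)) ⟨
  toℚᵘ (_/_ (+ (a ℕ.* b)) (n ℕ.* n′))     ∎)
  where open ℚᵘ.≃-Reasoning

½ : ℚ
½ = + 1 / 2

product-½ : ∀ {A : Set} (f : A → ℚ) (xs : List A) → (∀ x → f x ≡ ½) →
            List.foldr _*_ 1ℚ (List.map f xs) ≡ _/_ (+ 1) (2 ℕ.^ length xs) {{ℕ.m^n≢0 2 (length xs)}}
product-½ f []       f≡½ = refl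
product-½ f (x ∷ xs) f≡½ =
  trans (cong₂ _*_ (f≡½ x) (product-½ f xs f≡½))
        (/-* 1 1 2 (2 ℕ.^ length xs) {{_}} {{ℕ.m^n≢0 2 (length xs)}})

sum-const : ∀ {A : Set} (f : A → ℚ) (xs : List A) N .{{_ : NonZero N}} →
            (∀ x → f x ≡ + 1 / N) → sumℚ (List.map f xs) ≡ + length xs / N
sum-const f []       N f≡ = sym (0/n≡0 N)
sum-const f (x ∷ xs) N f≡ = trans (cong₂ _+_ (f≡ x) (sum-const f xs N f≡)) (/-+ 1 (length xs) N)

probX-½ : (G : Graph) (X : Realization G) →
          probX G (half G) X ≡ _/_ (+ 1) (2 ℕ.^ m G) {{ℕ.m^n≢0 2 (m G)}}
probX-½ G X = trans (product-½ _ (allFin (m G)) (λ e → factor (lookup X e)))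
                    (cong (λ k → _/_ (+ 1) (2 ℕ.^ k) {{ℕ.m^n≢0 2 k}}) (length-tabulate {n = m G} (λ e → e)))
  where
  factor : ∀ b → (if b then 1ℚ - ½ else ½) ≡ ½
  factor true  = refl
  factor false = refl

lemma1 : (G : Graph) (dec : Decidable (Φ G)) →
         (#F G ≡ card-Ωf G dec) × (unreliability G dec (half G) ≡ #F G /2^ m G)
lemma1 G dec = #F≡card-Ωf G dec , (begin
  unreliability G dec (half G)
    ≡⟨ sum-const (probX G (half G)) Ωf (2 ℕ.^ m G) {{ℕ.m^n≢0 2 (m G)}} (probX-½ G) ⟩
  length Ωf /2^ m G
    ≡⟨ cong (_/2^ m G) (sym (#F≡card-Ωf G dec)) ⟩
  #F G /2^ m G ∎)
  where
  open ≡-Reasoning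
  Ωf : List (Realization G)
  Ωf = filter (λ X → ¬? (dec X)) (allVecs (m G))
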